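{- For every $n\geq 1$, the number of shallow $231$-avoiding centrosymmetric permutations of length $n$ is $2^{\lfloor n/2\rfloor}$.
   Context: For $\pi=\pi_1\cdots\pi_n \in S_n$: $D(\pi)=\sum_{i=1}^n|\pi_i-i|$; $I(\pi)=|\{(i,j): i<j,\ \pi_i>\pi_j\}|$; $T(\pi)=n-\mathrm{cyc}(\pi)$ where $\mathrm{cyc}(\pi)$ is the number of cycles of $\pi$. $\pi$ is shallow if $I(\pi)+T(\pi)=D(\pi)$. $\pi$ avoids $231$ if there are no $i<j<k$ with $\pi_k<\pi_i<\pi_j$. The reverse-complement $\pi^{rc}$ is defined by $\pi^{rc}_{n+1-i}=n+1-\pi_i$; $\pi$ is centrosymmetric if $\pi=\pi^{rc}$. -}

module Defs where

open import Data.Nat using (ℕ; zero; suc; _+_; _∸_; _<ᵇ_; _≡ᵇ_; _≤ᵇ_)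
open import Data.Fin using (Fin; toℕ; opposite)
open import Data.Vec using (Vec; lookup)
open import Data.Bool using (Bool; true; false; _∧_; _∨_; not; T)
open import Data.List using (List; []; _∷_; length; filter; map; allFin)
open import Data.Bool.ListAction using (and; or)
open import Data.Bool using (T?)
open import Data.Product using (Σ)
open import Function using (_∘_)
open import Relation.Nullary.Decidable using (does)
open import Data.Fin using (_≟_)

-- A word of length n over Fin n; π i = lookup v i (0-indexed; values shifted by 1
-- relative to the paper, which does not affect any of the statistics below).
Word : ℕ → Set
Word n = Vec (Fin n) n

idx : (n : ℕ) → List (Fin n)
idx n = allFin n

-- v is a permutation: injective (hence bijective on Fin n)
isPerm : ∀ {n} → Word n → Bool
isPerm {n} v = and (map (λ i → and (map (λ j →
  not (does (lookup v i ≟ lookup v j)) ∨ does (i ≟ j)) (idx n))) (idx n))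

absDiff : ℕ → ℕ → ℕ
absDiff a b = (a ∸ b) + (b ∸ a)

sumL : List ℕ → ℕ
sumL [] = 0
sumL (x ∷ xs) = x + sumL xs

count : ∀ {A : Set} → (A → Bool) → List A → ℕ
count p xs = length (filter (λ x → T? (p x)) xs)

Dstat : ∀ {n} → Word n → ℕ
Dstat {n} v = sumL (map (λ i → absDiff (toℕ (lookup v i)) (toℕ i)) (idx n))

Istat : ∀ {n} → Word n → ℕ
Istat {n} v = sumL (map (λ i → count (λ j →
  (toℕ i <ᵇ toℕ j) ∧ (toℕ (lookup v j) <ᵇ toℕ (lookup v i))) (idx n)) (idx n))

iter : ∀ {n} → Word n → ℕ → Fin n → Fin n
iter v zero i = i
iter v (suc k) i = lookup v (iter v k i)

-- cyc(π): number of cycles, counted by their minimal element: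
-- i is the minimum of its cycle iff π^k(i) ≥ i for all 1 ≤ k ≤ n.
isCycleMin : ∀ {n} → Word n → Fin n → Bool
isCycleMin {n} v i = and (map (λ k → toℕ i ≤ᵇ toℕ (iter v (suc (toℕ k)) i)) (idx n))

cyc : ∀ {n} → Word n → ℕ
cyc {n} v = count (isCycleMin v) (idx n)

Tstat : ∀ {n} → Word n → ℕ
Tstat {n} v = n ∸ cyc v

isShallow : ∀ {n} → Word n → Bool
isShallow v = (Istat v + Tstat v) ≡ᵇ Dstat v

avoids231 : ∀ {n} → Word n → Bool
avoids231 {n} v = not (or (map (λ i → or (map (λ j → or (map (λ k →
  (toℕ i <ᵇ toℕ j) ∧ (toℕ j <ᵇ toℕ k) ∧
  (toℕ (lookup v k) <ᵇ toℕ (lookup v i)) ∧ (toℕ (lookup v i) <ᵇ toℕ (lookup v j)))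
  (idx n))) (idx n))) (idx n)))

-- centrosymmetric: π_{n+1-i} = n+1-π_i, i.e. (0-indexed) π(opposite i) = opposite (π i)
isCentrosymmetric : ∀ {n} → Word n → Bool
isCentrosymmetric {n} v = and (map (λ i →
  does (lookup v (opposite i) ≟ opposite (lookup v i))) (idx n))

isShallow231Centro : ∀ {n} → Word n → Bool
isShallow231Centro v = isPerm v ∧ isShallow v ∧ avoids231 v ∧ isCentrosymmetric v

-- the set of such permutations of length n, as a type (membership proof is T of a Bool,
-- hence proof-irrelevant, so its cardinality is the number of such permutations)
ShallowCentro231 : ℕ → Set
ShallowCentro231 n = Σ (Word n) (λ v → T (isShallow231Centro v))

{-# OPTIONS --safe #-}
module Submission where

-- A centrosymmetric permutation avoiding 231 also avoids 312, the reverse-complement of 231, and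
-- a permutation avoiding both is layered: an ascent separates all earlier values from all later
-- ones, so by pigeonhole each maximal descending run carries exactly the values of its own
-- positions, in reverse order. Conversely a layered permutation is a 231-avoiding involution,
-- and it is shallow because on a single reversed block of length r + 1 the statistics are
-- I = ∑ (r - t), T = #{t | r - t < t} and D = ∑ |r - 2t|, and I + T = D by a two-step induction
-- on r. A layered permutation is determined by its descent set, and it is centrosymmetric exactly
-- when that set is invariant under j ↦ n - 2 - j; such a set is determined by its first ⌊n/2⌋
-- entries, which can be chosen freely.

open import Defs
open import Data.Bool using (Bool; true; false; T; if_then_else_; _∧_; _∨_; not)
open import Data.Bool.ListAction using (all; any)
open import Data.Bool.Properties using (∧-zeroʳ; T-∧; T-irrelevant)
open import Data.Empty using (⊥; ⊥-elim)
import Data.Fin as F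
open F using (Fin; toℕ)
import Data.Fin.Properties as FP
open import Data.List using ([]; _∷_; map; allFin; tabulate)
open import Data.List.Properties using (map-tabulate)
import Data.List.Relation.Unary.All.Properties as All
import Data.List.Relation.Unary.Any.Properties as Any
open All using (all⁺; all⁻)
open Any using (any⁺; any⁻)
open import Data.Nat
  using (ℕ; zero; suc; pred; _⊓_; _+_; _*_; _∸_; _≤_; _<_; _≥_; _^_; _/_;
         z≤n; s≤s; z<s; s<s; s≤s⁻¹; _<ᵇ_; _≤ᵇ_; _<?_; _≤?_)
open import Data.Nat.DivMod using (m/n*n≤m; m*n/n≡m; /-monoˡ-≤)
open import Data.Nat.Induction using (<-wellFounded)
open import Data.Nat.Properties
open import Algebra.Properties.CommutativeSemigroup +-commutativeSemigroup
  using (interchange; xy∙z≈xz∙y; x∙yz≈y∙xz)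
open import Data.Nat.Tactic.RingSolver using (solve-∀)
open import Data.Product using (_×_; _,_; proj₁; proj₂; ∃)
open import Data.Product.Function.NonDependent.Propositional using (_×-↔_)
open import Data.Sum using (_⊎_; inj₁; inj₂; map₁)
open import Data.Unit using (⊤; tt)
import Data.Vec as V
open V using (Vec; lookup)
open import Data.Vec.Properties using (lookup∘tabulate; tabulate∘lookup; tabulate-cong)
open import Function using (id; case_of_)
open import Function.Bundles using (Equivalence; _↔_; mk↔ₛ′)
open Equivalence using (to; from)
open import Function.Properties.Inverse using (↔-trans; ↔-sym)
open import Induction.WellFounded using (Acc; acc)
open import Relation.Binary.PropositionalEquality
open import Relation.Nullary using (¬_; Dec; yes; no; does)

∑< : ℕ → (ℕ → ℕ) → ℕ
∑< zero    f = 0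
∑< (suc n) f = f 0 + ∑< n (λ i → f (suc i))

syntax ∑< n (λ i → x) = ∑[ i < n ] x

𝟙 : Bool → ℕ
𝟙 true  = 1
𝟙 false = 0

<ᵇ-true : ∀ {a b} → a < b → (a <ᵇ b) ≡ true
<ᵇ-true {zero}  (s≤s _)   = refl
<ᵇ-true {suc a} (s≤s a<b) = <ᵇ-true a<b

<ᵇ-false : ∀ {a b} → b ≤ a → (a <ᵇ b) ≡ false
<ᵇ-false z≤n       = refl
<ᵇ-false (s≤s b≤a) = <ᵇ-false b≤a

+-<ᵇ : ∀ s a b → (s + a <ᵇ s + b) ≡ (a <ᵇ b)
+-<ᵇ zero    a b = refl
+-<ᵇ (suc s) a b = +-<ᵇ s a b

∸-<ᵇ : ∀ {m a b} → a ≤ m → b ≤ m → (m ∸ a <ᵇ m ∸ b) ≡ (b <ᵇ a)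
∸-<ᵇ {m} {a} {b} a≤m b≤m with b <? a
... | yes b<a = trans (<ᵇ-true (∸-monoʳ-< b<a a≤m)) (sym (<ᵇ-true b<a))
... | no  b≮a = trans (<ᵇ-false (∸-monoʳ-≤ m (≮⇒≥ b≮a))) (sym (<ᵇ-false (≮⇒≥ b≮a)))

𝟙≤ᵇ+𝟙<ᵇ : ∀ a b → 𝟙 (a ≤ᵇ b) + 𝟙 (b <ᵇ a) ≡ 1
𝟙≤ᵇ+𝟙<ᵇ zero          b       = refl
𝟙≤ᵇ+𝟙<ᵇ (suc a)       zero    = refl
𝟙≤ᵇ+𝟙<ᵇ (suc zero)    (suc b) = refl
𝟙≤ᵇ+𝟙<ᵇ (suc (suc a)) (suc b) = 𝟙≤ᵇ+𝟙<ᵇ (suc a) b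

+-absDiff : ∀ s a b → absDiff (s + a) (s + b) ≡ absDiff a b
+-absDiff s a b = cong₂ _+_ ([m+n]∸[m+o]≡n∸o s a b) ([m+n]∸[m+o]≡n∸o s b a)

∑-cong : ∀ n {f g : ℕ → ℕ} → (∀ i → i < n → f i ≡ g i) → ∑< n f ≡ ∑< n g
∑-cong zero    f≗g = refl
∑-cong (suc n) f≗g = cong₂ _+_ (f≗g 0 z<s) (∑-cong n (λ i i<n → f≗g (suc i) (s<s i<n)))

∑-const : ∀ n c {f : ℕ → ℕ} → (∀ i → i < n → f i ≡ c) → ∑< n f ≡ n * c
∑-const zero    c f≡c = refl
∑-const (suc n) c f≡c = cong₂ _+_ (f≡c 0 z<s) (∑-const n c (λ i i<n → f≡c (suc i) (s<s i<n)))

∑-+ : ∀ a b (f : ℕ → ℕ) → ∑< (a + b) f ≡ ∑< a f + ∑[ i < b ] f (a + i)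
∑-+ zero    b f = refl
∑-+ (suc a) b f = trans (cong (f 0 +_) (∑-+ a b (λ i → f (suc i)))) (sym (+-assoc (f 0) _ _))

∑-distrib-+ : ∀ n (f g : ℕ → ℕ) → ∑[ i < n ] (f i + g i) ≡ ∑< n f + ∑< n g
∑-distrib-+ zero    f g = refl
∑-distrib-+ (suc n) f g =
  trans (cong (f 0 + g 0 +_) (∑-distrib-+ n _ _)) (interchange (f 0) (g 0) _ _)

∑-snoc : ∀ n (f : ℕ → ℕ) → ∑< (suc n) f ≡ ∑< n f + f n
∑-snoc zero    f = +-comm (f 0) 0
∑-snoc (suc n) f = trans (cong (f 0 +_) (∑-snoc n (λ i → f (suc i)))) (sym (+-assoc (f 0) _ _))

∑-outer : ∀ n (f : ℕ → ℕ) → ∑< (suc (suc n)) f ≡ f 0 + (∑[ i < n ] f (suc i) + f (suc n))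
∑-outer n f = cong (f 0 +_) (∑-snoc n (λ i → f (suc i)))

∑-indicator-interval : ∀ a b c {f : ℕ → ℕ} →
  (∀ j → j < a → f j ≡ 0) → (∀ j → j < b → f (a + j) ≡ 1) → (∀ j → j < c → f (a + b + j) ≡ 0) →
  ∑< (a + b + c) f ≡ b
∑-indicator-interval a b c {f} before inside after = begin
    ∑< (a + b + c) f
  ≡⟨ ∑-+ (a + b) c f ⟩
    ∑< (a + b) f + ∑[ j < c ] f (a + b + j)
  ≡⟨ cong₂ _+_ (∑-+ a b f) (∑-const c 0 after) ⟩
    ∑< a f + ∑[ j < b ] f (a + j) + c * 0
  ≡⟨ cong₂ (λ x y → x + y + c * 0) (∑-const a 0 before) (∑-const b 1 inside) ⟩
    a * 0 + b * 1 + c * 0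
  ≡⟨ only-middle a b c ⟩
    b ∎
  where
  open ≡-Reasoning
  only-middle : ∀ a b c → a * 0 + b * 1 + c * 0 ≡ b
  only-middle = solve-∀

∑-𝟙-complement : ∀ n (a b : ℕ → ℕ) → n ∸ ∑[ i < n ] 𝟙 (a i ≤ᵇ b i) ≡ ∑[ i < n ] 𝟙 (b i <ᵇ a i)
∑-𝟙-complement n a b = trans (cong (_∸ ∑≤) n≡∑≤+∑>) (m+n∸m≡n ∑≤ ∑>)
  where
  open ≡-Reasoning
  ∑≤ ∑> : ℕ
  ∑≤ = ∑[ i < n ] 𝟙 (a i ≤ᵇ b i)
  ∑> = ∑[ i < n ] 𝟙 (b i <ᵇ a i)
  n≡∑≤+∑> : n ≡ ∑≤ + ∑>
  n≡∑≤+∑> = begin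
    n                                              ≡⟨ *-identityʳ n ⟨
    n * 1                                          ≡⟨ ∑-const n 1 (λ i _ → 𝟙≤ᵇ+𝟙<ᵇ (a i) (b i)) ⟨
    ∑[ i < n ] (𝟙 (a i ≤ᵇ b i) + 𝟙 (b i <ᵇ a i))  ≡⟨ ∑-distrib-+ n _ _ ⟩
    ∑≤ + ∑>                                        ∎

-- Position t of the reversal of 0, …, r is the left end of r ∸ t inversions, the upper end of a
-- transposition exactly when r ∸ t < t, and displaced by ∣(r ∸ t) - t∣.
reversal-shallow : ∀ r → ∑[ t < suc r ] ((r ∸ t) + 𝟙 (r ∸ t <ᵇ t)) ≡ ∑[ t < suc r ] absDiff (r ∸ t) t
reversal-shallow zero          = refl
reversal-shallow (suc zero)    = refl
reversal-shallow (suc (suc r)) = begin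
    ∑[ t < 3 + r ] I+T (2 + r) t
  ≡⟨ ∑-outer (suc r) (I+T (2 + r)) ⟩
    I+T (2 + r) 0 + (∑[ t < 1 + r ] I+T (2 + r) (suc t) + I+T (2 + r) (2 + r))
  ≡⟨ cong₂ _+_ (+-identityʳ (2 + r)) (cong₂ _+_ (∑-cong (suc r) inner-I+T) last-I+T) ⟩
    (2 + r) + (∑[ t < 1 + r ] (I+T r t + 1) + 1)
  ≡⟨ cong (λ x → (2 + r) + (x + 1)) ∑I+T+1 ⟩
    (2 + r) + (∑[ t < 1 + r ] I+T r t + (1 + r) * 1 + 1)
  ≡⟨ cong (λ x → (2 + r) + (x + (1 + r) * 1 + 1)) (reversal-shallow r) ⟩
    (2 + r) + (∑[ t < 1 + r ] D r t + (1 + r) * 1 + 1)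
  ≡⟨ regroup r _ ⟩
    (2 + r) + (∑[ t < 1 + r ] D r t + (2 + r))
  ≡⟨ cong₂ _+_ (+-identityʳ (2 + r)) (cong₂ _+_ (∑-cong (suc r) inner-D) last-D) ⟨
    D (2 + r) 0 + (∑[ t < 1 + r ] D (2 + r) (suc t) + D (2 + r) (2 + r))
  ≡⟨ ∑-outer (suc r) (D (2 + r)) ⟨
    ∑[ t < 3 + r ] D (2 + r) t ∎
  where
  open ≡-Reasoning
  I+T D : ℕ → ℕ → ℕ
  I+T r t = (r ∸ t) + 𝟙 (r ∸ t <ᵇ t)
  D   r t = absDiff (r ∸ t) t
  inner-I+T : ∀ t → t < suc r → I+T (2 + r) (suc t) ≡ I+T r t + 1
  inner-I+T t t≤r rewrite +-∸-assoc 1 (s≤s⁻¹ t≤r) = +-comm 1 _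
  inner-D : ∀ t → t < suc r → D (2 + r) (suc t) ≡ D r t
  inner-D t t≤r rewrite +-∸-assoc 1 (s≤s⁻¹ t≤r) = refl
  last-I+T : I+T (2 + r) (2 + r) ≡ 1
  last-I+T rewrite n∸n≡0 r = refl
  last-D : D (2 + r) (2 + r) ≡ 2 + r
  last-D rewrite n∸n≡0 r = refl
  ∑I+T+1 : ∑[ t < 1 + r ] (I+T r t + 1) ≡ ∑[ t < 1 + r ] I+T r t + (1 + r) * 1
  ∑I+T+1 = trans (∑-distrib-+ (suc r) (I+T r) (λ _ → 1))
                 (cong (∑< (suc r) (I+T r) +_) (∑-const (suc r) 1 (λ _ _ → refl)))
  regroup : ∀ r x → (2 + r) + (x + (1 + r) * 1 + 1) ≡ (2 + r) + (x + (2 + r))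
  regroup = solve-∀

pigeonhole : ∀ L {lo hi} (f : ℕ → ℕ) → (∀ t → t < L → lo ≤ f t × f t < hi) →
             (∀ s t → s < L → t < L → f s ≡ f t → s ≡ t) → L ≤ hi ∸ lo
pigeonhole L {lo} {hi} f range injective = FP.injective⇒≤ {f = g} g-injective
  where
  g : Fin L → Fin (hi ∸ lo)
  g x = F.fromℕ< (∸-monoˡ-< (proj₂ (range _ (FP.toℕ<n x))) (proj₁ (range _ (FP.toℕ<n x))))
  g-injective : ∀ {x y} → g x ≡ g y → x ≡ y
  g-injective {x} {y} gx≡gy = FP.toℕ-injective (injective _ _ (FP.toℕ<n x) (FP.toℕ<n y)
    (∸-cancelʳ-≡ (proj₁ (range _ (FP.toℕ<n x))) (proj₁ (range _ (FP.toℕ<n y)))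
      (FP.fromℕ<-injective _ _ _ _ gx≡gy)))

m<n∸o⇒o+m<n : ∀ {m n o} → o ≤ n → m < n ∸ o → o + m < n
m<n∸o⇒o+m<n {o = o} o≤n m<n∸o = <-≤-trans (+-monoʳ-< o m<n∸o) (≤-reflexive (m+[n∸m]≡n o≤n))

∸-suc-involutive : ∀ {m j} → j < m → m ∸ suc (m ∸ suc j) ≡ j
∸-suc-involutive {m} {j} j<m =
  trans (sym (pred[m∸n]≡m∸[1+n] m (m ∸ suc j))) (cong pred (m∸[m∸n]≡n j<m))

reflect : ℕ → ℕ → ℕ → ℕ
reflect s e i = s + (e ∸ i)

module _ {s i e : ℕ} (s≤i : s ≤ i) (i≤e : i ≤ e) where

  reflect+shift≡end : reflect s e i + (i ∸ s) ≡ e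
  reflect+shift≡end with m≤n⇒∃[o]m+o≡n s≤i | m≤n⇒∃[o]m+o≡n i≤e
  ... | a , refl | b , refl rewrite m+n∸m≡n (s + a) b | m+n∸m≡n s a = xy∙z≈xz∙y s b a

  reflect-involutive : reflect s e (reflect s e i) ≡ i
  reflect-involutive with m≤n⇒∃[o]m+o≡n s≤i | m≤n⇒∃[o]m+o≡n i≤e
  ... | a , refl | b , refl rewrite m+n∸m≡n (s + a) b | xy∙z≈xz∙y s a b | m+n∸m≡n (s + b) a = refl

  reflect-complement : ∀ {M} → e ≤ M → reflect (M ∸ e) (M ∸ s) (M ∸ i) ≡ M ∸ reflect s e i
  reflect-complement e≤M with m≤n⇒∃[o]m+o≡n s≤i | m≤n⇒∃[o]m+o≡n i≤e | m≤n⇒∃[o]m+o≡n e≤M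
  ... | a , refl | b , refl | c , refl
    rewrite m+n∸m≡n (s + a + b) c | m+n∸m≡n (s + a) b
          | +-assoc (s + a) b c | m+n∸m≡n (s + a) (b + c)
          | +-assoc s a (b + c) | m+n∸m≡n s (a + (b + c))
          | [m+n]∸[m+o]≡n∸o s (a + (b + c)) b | m+n∸n≡m a (b + c)
          | x∙yz≈y∙xz a b c | m+n∸m≡n b (a + c) = +-comm c a

-- A permutation of length m + 1 is handled through its values v 0, …, v m; the values of v at
-- larger arguments never matter.

Bounded : ℕ → (ℕ → ℕ) → Set
Bounded m v = ∀ {i} → i ≤ m → v i ≤ m

InjectiveUpTo : ℕ → (ℕ → ℕ) → Set
InjectiveUpTo m v = ∀ {i j} → i ≤ m → j ≤ m → v i ≡ v j → i ≡ j

Avoids231 : ℕ → (ℕ → ℕ) → Set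
Avoids231 m v = ∀ {i j k} → i < j → j < k → k ≤ m → v k < v i → v i < v j → ⊥

Avoids312 : ℕ → (ℕ → ℕ) → Set
Avoids312 m v = ∀ {i j k} → i < j → j < k → k ≤ m → v j < v k → v k < v i → ⊥

Centrosymmetric : ℕ → (ℕ → ℕ) → Set
Centrosymmetric m v = ∀ {i} → i ≤ m → v (m ∸ i) ≡ m ∸ v i

descents : (ℕ → ℕ) → ℕ → Bool
descents v j = v (suc j) <ᵇ v j

Palindromic : ℕ → (ℕ → Bool) → Set
Palindromic m d = ∀ {j} → j < m → d (m ∸ suc j) ≡ d j

reverse-complement-231⇒312 : ∀ {m v} → Bounded m v → Centrosymmetric m v →
                             Avoids231 m v → Avoids312 m v
reverse-complement-231⇒312 {m} {v} v-bounded centro avoids {i} {j} {k} i<j j<k k≤m vj<vk vk<vi =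
  avoids (∸-monoʳ-< j<k k≤m) (∸-monoʳ-< i<j j≤m) (m∸n≤m m i)
    (subst₂ _<_ (sym (centro i≤m)) (sym (centro k≤m)) (∸-monoʳ-< vk<vi (v-bounded i≤m)))
    (subst₂ _<_ (sym (centro k≤m)) (sym (centro j≤m)) (∸-monoʳ-< vj<vk (v-bounded k≤m)))
  where
  j≤m = ≤-trans (<⇒≤ j<k) k≤m
  i≤m = ≤-trans (<⇒≤ i<j) j≤m

descents-palindromic : ∀ {m v} → Bounded m v → Centrosymmetric m v → Palindromic m (descents v)
descents-palindromic {m} {v} v-bounded centro {j} j<m = begin
    v (suc (m ∸ suc j)) <ᵇ v (m ∸ suc j)
  ≡⟨ cong (λ i → v i <ᵇ v (m ∸ suc j)) (+-∸-assoc 1 j<m) ⟨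
    v (m ∸ j) <ᵇ v (m ∸ suc j)
  ≡⟨ cong₂ _<ᵇ_ (centro (<⇒≤ j<m)) (centro j<m) ⟩
    m ∸ v j <ᵇ m ∸ v (suc j)
  ≡⟨ ∸-<ᵇ (v-bounded (<⇒≤ j<m)) (v-bounded j<m) ⟩
    v (suc j) <ᵇ v j ∎
  where open ≡-Reasoning

-- Layered permutations

-- d j says that positions j and j + 1 lie in the same layer; π reverses every layer in place.
module Layered (m : ℕ) (d : ℕ → Bool) where

  start : ℕ → ℕ
  start zero    = 0
  start (suc i) = if d i then start i else suc i

  endWithin : ℕ → ℕ → ℕ
  endWithin zero    i = i
  endWithin (suc k) i = if d i then endWithin k (suc i) else i

  end : ℕ → ℕ
  end i = endWithin (m ∸ i) i

  IsStart : ℕ → Set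
  IsStart zero    = ⊤
  IsStart (suc s) = d s ≡ false

  IsEnd : ℕ → Set
  IsEnd e = e ≡ m ⊎ d e ≡ false

  Run : ℕ → ℕ → Set
  Run s e = ∀ j → s ≤ j → j < e → d j ≡ true

  run-join : ∀ {s i e} → Run s i → Run i e → Run s e
  run-join {i = i} sRi iRe j s≤j j<e with j <? i
  ... | yes j<i = sRi j s≤j j<i
  ... | no  j≮i = iRe j (≮⇒≥ j≮i) j<e

  run-mono : ∀ {s e s′ e′} → s ≤ s′ → e′ ≤ e → Run s e → Run s′ e′
  run-mono s≤s′ e′≤e sRe j s′≤j j<e′ = sRe j (≤-trans s≤s′ s′≤j) (<-≤-trans j<e′ e′≤e)

  empty-run : ∀ i → Run i i
  empty-run i j i≤j j<i = ⊥-elim (<⇒≱ j<i i≤j)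

  start-≤ : ∀ i → start i ≤ i
  start-≤ zero = z≤n
  start-≤ (suc i) with d i
  ... | true  = m≤n⇒m≤1+n (start-≤ i)
  ... | false = ≤-refl

  start-isStart : ∀ i → IsStart (start i)
  start-isStart zero = tt
  start-isStart (suc i) with d i in di
  ... | true  = start-isStart i
  ... | false = di

  start-run : ∀ i → Run (start i) i
  start-run (suc i) j s≤j j<1+i with d i in di | m≤n⇒m<n∨m≡n (s≤s⁻¹ j<1+i)
  ... | true  | inj₁ j<i  = start-run i j s≤j j<i
  ... | true  | inj₂ refl = di
  ... | false | _         = ⊥-elim (<⇒≱ j<1+i s≤j)

  start-unique : ∀ {s i} → IsStart s → s ≤ i → Run s i → start i ≡ s
  start-unique {zero}  {zero}  _  _   _   = refl
  start-unique {suc s} {zero}  _  ()  _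
  start-unique {s}     {suc i} st s≤i sRi with m≤n⇒m<n∨m≡n s≤i
  ... | inj₁ s<1+i rewrite sRi i (s≤s⁻¹ s<1+i) ≤-refl =
    start-unique st (s≤s⁻¹ s<1+i) (run-mono ≤-refl (n≤1+n i) sRi)
  ... | inj₂ refl rewrite st = refl

  endWithin-≥ : ∀ k i → i ≤ endWithin k i
  endWithin-≥ zero    i = ≤-refl
  endWithin-≥ (suc k) i with d i
  ... | true  = ≤-trans (n≤1+n i) (endWithin-≥ k (suc i))
  ... | false = ≤-refl

  endWithin-≤ : ∀ k i → endWithin k i ≤ i + k
  endWithin-≤ zero    i = m≤m+n i 0
  endWithin-≤ (suc k) i with d i
  ... | true  = ≤-trans (endWithin-≤ k (suc i)) (≤-reflexive (sym (+-suc i k)))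
  ... | false = m≤m+n i (suc k)

  endWithin-run : ∀ k i → Run i (endWithin k i)
  endWithin-run zero    i = empty-run i
  endWithin-run (suc k) i j i≤j j<e with d i in di | m≤n⇒m<n∨m≡n i≤j
  ... | true  | inj₁ i<j  = endWithin-run k (suc i) j i<j j<e
  ... | true  | inj₂ refl = di
  ... | false | _         = ⊥-elim (<⇒≱ j<e i≤j)

  endWithin-stops : ∀ k i → endWithin k i ≡ i + k ⊎ d (endWithin k i) ≡ false
  endWithin-stops zero    i = inj₁ (sym (+-identityʳ i))
  endWithin-stops (suc k) i with d i in di
  ... | false = inj₂ di
  ... | true with endWithin-stops k (suc i)
  ...   | inj₁ e≡i+k = inj₁ (trans e≡i+k (sym (+-suc i k)))
  ...   | inj₂ de≡f  = inj₂ de≡f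

  endWithin-unique : ∀ k {i e} → e ≡ i + k ⊎ d e ≡ false → i ≤ e → e ≤ i + k → Run i e →
                     endWithin k i ≡ e
  endWithin-unique zero    {i} _    i≤e e≤i _ = ≤-antisym i≤e (≤-trans e≤i (≤-reflexive (+-identityʳ i)))
  endWithin-unique (suc k) {i} stop i≤e e≤ iRe with m≤n⇒m<n∨m≡n i≤e
  ... | inj₁ i<e rewrite iRe i ≤-refl i<e =
    endWithin-unique k (map₁ (λ e≡ → trans e≡ (+-suc i k)) stop) i<e
      (≤-trans e≤ (≤-reflexive (+-suc i k))) (run-mono (n≤1+n i) ≤-refl iRe)
  ... | inj₂ refl with d i | stop
  ...   | false | _        = refl
  ...   | true  | inj₁ i≡ = ⊥-elim (m+1+n≢m i (sym i≡))
  ...   | true  | inj₂ ()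

  ≤-end : ∀ i → i ≤ end i
  ≤-end i = endWithin-≥ (m ∸ i) i

  end-≤ : ∀ {i} → i ≤ m → end i ≤ m
  end-≤ {i} i≤m = ≤-trans (endWithin-≤ (m ∸ i) i) (≤-reflexive (m+[n∸m]≡n i≤m))

  end-run : ∀ i → Run i (end i)
  end-run i = endWithin-run (m ∸ i) i

  end-isEnd : ∀ {i} → i ≤ m → IsEnd (end i)
  end-isEnd {i} i≤m = map₁ (λ e≡ → trans e≡ (m+[n∸m]≡n i≤m)) (endWithin-stops (m ∸ i) i)

  end-unique : ∀ {i e} → IsEnd e → i ≤ e → e ≤ m → Run i e → end i ≡ e
  end-unique {i} stop i≤e e≤m =
    endWithin-unique (m ∸ i) (map₁ (λ e≡ → trans e≡ (sym i+[m∸i]≡m)) stop) i≤e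
      (≤-trans e≤m (≤-reflexive (sym i+[m∸i]≡m)))
    where
    i+[m∸i]≡m : i + (m ∸ i) ≡ m
    i+[m∸i]≡m = m+[n∸m]≡n (≤-trans i≤e e≤m)

  layer-run : ∀ i → Run (start i) (end i)
  layer-run i = run-join (start-run i) (end-run i)

  same-layer : ∀ {i j} → i ≤ m → start i ≤ j → j ≤ end i → start j ≡ start i × end j ≡ end i
  same-layer {i} i≤m s≤j j≤e =
    start-unique (start-isStart i) s≤j (run-mono ≤-refl j≤e (layer-run i)) ,
    end-unique (end-isEnd i≤m) j≤e (end-≤ i≤m) (run-mono s≤j ≤-refl (layer-run i))

  later-layer : ∀ {i j} → i ≤ m → j ≤ m → end i < j → end i < start j
  later-layer {i} {j} i≤m j≤m e<j with start j ≤? end i | end-isEnd i≤m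
  ... | no  s≰e | _        = ≰⇒> s≰e
  ... | yes s≤e | inj₁ e≡m = ⊥-elim (<⇒≱ e<j (≤-trans j≤m (≤-reflexive (sym e≡m))))
  ... | yes s≤e | inj₂ d≡f with () ← trans (sym (start-run j (end i) s≤e e<j)) d≡f

  π : ℕ → ℕ
  π i = reflect (start i) (end i) i

  start≤π : ∀ i → start i ≤ π i
  start≤π i = m≤m+n (start i) _

  π≤end : ∀ i → π i ≤ end i
  π≤end i = ≤-trans (+-monoˡ-≤ (end i ∸ i) (start-≤ i)) (≤-reflexive (m+[n∸m]≡n (≤-end i)))

  π-bounded : Bounded m π
  π-bounded {i} i≤m = ≤-trans (π≤end i) (end-≤ i≤m)

  π+shift≡end : ∀ i → π i + (i ∸ start i) ≡ end i
  π+shift≡end i = reflect+shift≡end (start-≤ i) (≤-end i)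

  π-involutive : ∀ {i} → i ≤ m → π (π i) ≡ i
  π-involutive {i} i≤m with same-layer i≤m (start≤π i) (π≤end i)
  ... | s≡ , e≡ =
    trans (cong₂ (λ s e → reflect s e (π i)) s≡ e≡) (reflect-involutive (start-≤ i) (≤-end i))

  π-injective : InjectiveUpTo m π
  π-injective {i} {j} i≤m j≤m πi≡πj =
    trans (sym (π-involutive i≤m)) (trans (cong π πi≡πj) (π-involutive j≤m))

  π-decreasing : ∀ {i j} → i ≤ m → i < j → j ≤ end i → π j < π i
  π-decreasing {i} {j} i≤m i<j j≤e with same-layer i≤m (≤-trans (start-≤ i) (<⇒≤ i<j)) j≤e
  ... | s≡ , e≡ rewrite s≡ | e≡ = +-monoʳ-< (start i) (∸-monoʳ-< i<j j≤e)

  π-increasing : ∀ {i j} → i ≤ m → j ≤ m → end i < j → π i < π j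
  π-increasing {i} {j} i≤m j≤m e<j =
    ≤-<-trans (π≤end i) (<-≤-trans (later-layer i≤m j≤m e<j) (start≤π j))

  π-avoids-231 : Avoids231 m π
  π-avoids-231 {i} {j} {k} i<j j<k k≤m πk<πi πi<πj = case j ≤? end i of λ where
      (yes j≤e) → <-asym πi<πj (π-decreasing i≤m i<j j≤e)
      (no  j≰e) → <-asym πk<πi (π-increasing i≤m k≤m (<-trans (≰⇒> j≰e) j<k))
    where
    i≤m = ≤-trans (<⇒≤ i<j) (≤-trans (<⇒≤ j<k) k≤m)

  π-descents : ∀ {i} → i < m → descents π i ≡ d i
  π-descents {i} i<m = by-cases (d i) refl
    where
    by-cases : ∀ b → d i ≡ b → descents π i ≡ b
    by-cases true  di = <ᵇ-true (π-decreasing (<⇒≤ i<m) (n<1+n i) 1+i≤end)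
      where
      1+i≤end : suc i ≤ end i
      1+i≤end with end-isEnd (<⇒≤ i<m)
      ... | inj₁ e≡m = ≤-trans i<m (≤-reflexive (sym e≡m))
      ... | inj₂ de  = ≤∧≢⇒< (≤-end i) (λ i≡e → case trans (sym di) (trans (cong d i≡e) de) of λ ())
    by-cases false di = <ᵇ-false (<⇒≤ (π-increasing (<⇒≤ i<m) i<m (s≤s (≤-reflexive end≡i))))
      where
      end≡i : end i ≡ i
      end≡i = end-unique (inj₂ di) ≤-refl (<⇒≤ i<m) (empty-run i)

  module _ (palindromic : Palindromic m d) where

    end-reflect : ∀ {i} → i ≤ m → end i ≡ m ∸ start (m ∸ i)
    end-reflect {i} i≤m =
      end-unique (reflected-isEnd (start-isStart (m ∸ i)) (start-≤ (m ∸ i))) i≤m∸s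
                 (m∸n≤m m (start (m ∸ i))) reflected-run
      where
      s≤m : start (m ∸ i) ≤ m
      s≤m = ≤-trans (start-≤ (m ∸ i)) (m∸n≤m m i)
      i≤m∸s : i ≤ m ∸ start (m ∸ i)
      i≤m∸s = ≤-trans (≤-reflexive (sym (m∸[m∸n]≡n i≤m))) (∸-monoʳ-≤ m (start-≤ (m ∸ i)))
      reflected-isEnd : ∀ {s} → IsStart s → s ≤ m ∸ i → IsEnd (m ∸ s)
      reflected-isEnd {zero}  _   _     = inj₁ refl
      reflected-isEnd {suc s} d≡f s<m∸i = inj₂ (trans (palindromic (≤-trans s<m∸i (m∸n≤m m i))) d≡f)
      reflected-run : Run i (m ∸ start (m ∸ i))
      reflected-run j i≤j j<m∸s =
        trans (sym (palindromic j<m)) (start-run (m ∸ i) (m ∸ suc j) s≤m∸1+j (∸-monoʳ-< (s≤s i≤j) j<m))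
        where
        j<m = <-≤-trans j<m∸s (m∸n≤m m (start (m ∸ i)))
        s≤m∸1+j = m+n≤o⇒m≤o∸n _ (subst (_≤ m) (sym (+-suc _ j)) (m<n∸o⇒o+m<n s≤m j<m∸s))

    start-reflect : ∀ {i} → i ≤ m → start (m ∸ i) ≡ m ∸ end i
    start-reflect {i} i≤m =
      sym (trans (cong (m ∸_) (end-reflect i≤m)) (m∸[m∸n]≡n (≤-trans (start-≤ (m ∸ i)) (m∸n≤m m i))))

    π-reflect : Centrosymmetric m π
    π-reflect {i} i≤m = begin
        reflect (start (m ∸ i)) (end (m ∸ i)) (m ∸ i)
      ≡⟨ cong₂ (λ s e → reflect s e (m ∸ i)) (start-reflect i≤m) end-reflect′ ⟩
        reflect (m ∸ end i) (m ∸ start i) (m ∸ i)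
      ≡⟨ reflect-complement (start-≤ i) (≤-end i) (end-≤ i≤m) ⟩
        m ∸ π i ∎
      where
      open ≡-Reasoning
      end-reflect′ : end (m ∸ i) ≡ m ∸ start i
      end-reflect′ = trans (end-reflect (m∸n≤m m i)) (cong (λ x → m ∸ start x) (m∸[m∸n]≡n i≤m))

  inversions-from : ∀ {i} → i ≤ m → ∑[ j < suc m ] 𝟙 ((i <ᵇ j) ∧ (π j <ᵇ π i)) ≡ end i ∸ i
  inversions-from {i} i≤m =
    trans (cong (λ n → ∑[ j < n ] 𝟙 ((i <ᵇ j) ∧ (π j <ᵇ π i))) (sym total))
          (∑-indicator-interval (suc i) (end i ∸ i) (m ∸ end i) before inside after)
    where
    i+[e∸i]≡e : i + (end i ∸ i) ≡ end i
    i+[e∸i]≡e = m+[n∸m]≡n (≤-end i)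
    total : suc i + (end i ∸ i) + (m ∸ end i) ≡ suc m
    total = cong suc (trans (cong (_+ (m ∸ end i)) i+[e∸i]≡e) (m+[n∸m]≡n (end-≤ i≤m)))
    before : ∀ j → j < suc i → 𝟙 ((i <ᵇ j) ∧ (π j <ᵇ π i)) ≡ 0
    before j j≤i rewrite <ᵇ-false (s≤s⁻¹ j≤i) = refl
    inside : ∀ j → j < end i ∸ i → 𝟙 ((i <ᵇ suc i + j) ∧ (π (suc i + j) <ᵇ π i)) ≡ 1
    inside j j<e∸i rewrite <ᵇ-true (s≤s (m≤m+n i j)) =
      cong 𝟙 (<ᵇ-true (π-decreasing i≤m (s≤s (m≤m+n i j)) (m<n∸o⇒o+m<n (≤-end i) j<e∸i)))
    after : ∀ j → j < m ∸ end i →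
            𝟙 ((i <ᵇ suc i + (end i ∸ i) + j) ∧ (π (suc i + (end i ∸ i) + j) <ᵇ π i)) ≡ 0
    after j j<m∸e
      rewrite i+[e∸i]≡e
            | <ᵇ-false (<⇒≤ (π-increasing i≤m (m<n∸o⇒o+m<n (end-≤ i≤m) j<m∸e) (s≤s (m≤m+n (end i) j))))
      = cong 𝟙 (∧-zeroʳ (i <ᵇ suc (end i + j)))

  I+T D : ℕ → ℕ
  I+T i = (end i ∸ i) + 𝟙 (π i <ᵇ i)
  D   i = absDiff (π i) i

  layer-shallow : ∀ {e} → e ≤ m → IsEnd e →
    ∑[ t < suc (e ∸ start e) ] I+T (start e + t) ≡ ∑[ t < suc (e ∸ start e) ] D (start e + t)
  layer-shallow {e} e≤m isEnd =
    trans (∑-cong (suc r) I+T-shift) (trans (reversal-shallow r) (sym (∑-cong (suc r) D-shift)))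
    where
    s = start e
    r = e ∸ s
    s+r≡e : s + r ≡ e
    s+r≡e = m+[n∸m]≡n (start-≤ e)
    s+t≤e : ∀ {t} → t < suc r → s + t ≤ e
    s+t≤e t≤r = ≤-trans (+-monoʳ-≤ s (s≤s⁻¹ t≤r)) (≤-reflexive s+r≡e)
    in-layer : ∀ {t} → t < suc r → start (s + t) ≡ s × end (s + t) ≡ e
    in-layer {t} t≤r with same-layer e≤m (m≤m+n s t) (≤-trans (s+t≤e t≤r) (≤-end e))
    ... | s≡ , e≡ = s≡ , trans e≡ (end-unique isEnd ≤-refl e≤m (empty-run e))
    end-shift : ∀ {t} → t < suc r → end (s + t) ∸ (s + t) ≡ r ∸ t
    end-shift {t} t≤r =
      trans (cong (_∸ (s + t)) (trans (proj₂ (in-layer t≤r)) (sym s+r≡e))) ([m+n]∸[m+o]≡n∸o s r t)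
    π-shift : ∀ {t} → t < suc r → π (s + t) ≡ s + (r ∸ t)
    π-shift t≤r = cong₂ _+_ (proj₁ (in-layer t≤r)) (end-shift t≤r)
    I+T-shift : ∀ t → t < suc r → I+T (s + t) ≡ (r ∸ t) + 𝟙 (r ∸ t <ᵇ t)
    I+T-shift t t≤r =
      cong₂ _+_ (end-shift t≤r) (cong 𝟙 (trans (cong (_<ᵇ s + t) (π-shift t≤r)) (+-<ᵇ s (r ∸ t) t)))
    D-shift : ∀ t → t < suc r → D (s + t) ≡ absDiff (r ∸ t) t
    D-shift t t≤r = trans (cong (λ x → absDiff x (s + t)) (π-shift t≤r)) (+-absDiff s (r ∸ t) t)

  Boundary : ℕ → Set
  Boundary zero    = ⊤
  Boundary (suc e) = e ≤ m × IsEnd e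

  start-boundary : ∀ {e} → e ≤ m → Boundary (start e)
  start-boundary {e} e≤m with start e | start-isStart e | start-≤ e
  ... | zero  | _   | _   = tt
  ... | suc s | d≡f | s<e = ≤-trans (<⇒≤ s<e) e≤m , inj₂ d≡f

  ∑-upto-boundary : ∀ {k} → Acc _<_ k → Boundary k → ∑< k I+T ≡ ∑< k D
  ∑-upto-boundary {zero}  _         _              = refl
  ∑-upto-boundary {suc e} (acc rec) (e≤m , isEnd) = begin
      ∑< (suc e) I+T
    ≡⟨ cong (λ n → ∑< n I+T) s+1+r≡1+e ⟨
      ∑< (s + suc r) I+T
    ≡⟨ ∑-+ s (suc r) I+T ⟩
      ∑< s I+T + ∑[ t < suc r ] I+T (s + t)
    ≡⟨ cong₂ _+_ (∑-upto-boundary (rec (s≤s (start-≤ e))) (start-boundary e≤m)) (layer-shallow e≤m isEnd) ⟩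
      ∑< s D + ∑[ t < suc r ] D (s + t)
    ≡⟨ ∑-+ s (suc r) D ⟨
      ∑< (s + suc r) D
    ≡⟨ cong (λ n → ∑< n D) s+1+r≡1+e ⟩
      ∑< (suc e) D ∎
    where
    open ≡-Reasoning
    s = start e
    r = e ∸ s
    s+1+r≡1+e : s + suc r ≡ suc e
    s+1+r≡1+e = trans (+-suc s r) (cong suc (m+[n∸m]≡n (start-≤ e)))

  layered-shallow : ∑[ i < suc m ] (end i ∸ i) + ∑[ i < suc m ] 𝟙 (π i <ᵇ i) ≡ ∑[ i < suc m ] absDiff (π i) i
  layered-shallow = trans (sym (∑-distrib-+ (suc m) (λ i → end i ∸ i) (λ i → 𝟙 (π i <ᵇ i))))
                          (∑-upto-boundary (<-wellFounded (suc m)) (≤-refl , inj₁ refl))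

-- Avoiders of 231 and 312 are layered

module _ {m : ℕ} {v : ℕ → ℕ} (v-bounded : Bounded m v) (v-injective : InjectiveUpTo m v)
         (avoids-231 : Avoids231 m v) (avoids-312 : Avoids312 m v)
         (d : ℕ → Bool) (d-descents : ∀ {j} → j < m → d j ≡ descents v j) where

  open Layered m d

  private
    v-< : ∀ {a b} → a < b → b ≤ m → ¬ (v b < v a) → v a < v b
    v-< a<b b≤m vb≮va =
      ≤∧≢⇒< (≮⇒≥ vb≮va) (λ va≡vb → <⇒≢ a<b (v-injective (≤-trans (<⇒≤ a<b) b≤m) b≤m va≡vb))

    descent-at : ∀ {j} → j < m → d j ≡ true → v (suc j) < v j
    descent-at {j} j<m d≡t = <ᵇ⇒< _ _ (subst T (trans (sym d≡t) (d-descents j<m)) tt)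

    ascent-at : ∀ {j} → j < m → d j ≡ false → v j < v (suc j)
    ascent-at {j} j<m d≡f = v-< (n<1+n j) j<m λ v1+j<vj →
      case trans (sym d≡f) (trans (d-descents j<m) (<ᵇ-true v1+j<vj)) of λ ()

    ascent-separates : ∀ {i j k} → v i < v (suc i) → j ≤ i → i < k → k ≤ m → v j < v k
    ascent-separates {i} {j} {k} ascent j≤i i<k k≤m =
      v-< (≤-<-trans j≤i i<k) k≤m (no-inversion (m≤n⇒m<n∨m≡n j≤i))
      where
      vi<vk : v i < v k
      vi<vk with m≤n⇒m<n∨m≡n i<k
      ... | inj₂ refl  = ascent
      ... | inj₁ 1+i<k = v-< i<k k≤m (λ vk<vi → avoids-231 (n<1+n i) 1+i<k k≤m vk<vi ascent)
      no-inversion : j < i ⊎ j ≡ i → ¬ (v k < v j)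
      no-inversion (inj₂ refl) = <⇒≯ vi<vk
      no-inversion (inj₁ j<i)  = avoids-312 j<i i<k k≤m vi<vk

    ascent-prefix : ∀ {j k} → j < m → v j < v (suc j) → j < k → k ≤ m → suc j ≤ v k
    ascent-prefix {j} {k} j<m ascent j<k k≤m =
      pigeonhole (suc j) v (λ t t≤j → z≤n , ascent-separates ascent (s≤s⁻¹ t≤j) j<k k≤m)
        (λ s t s≤j t≤j → v-injective (≤-trans (s≤s⁻¹ s≤j) (<⇒≤ j<m)) (≤-trans (s≤s⁻¹ t≤j) (<⇒≤ j<m)))

    ascent-suffix : ∀ {j k} → j < m → v j < v (suc j) → k ≤ j → v k ≤ j
    ascent-suffix {j} {k} j<m ascent k≤j = ∸-cancelʳ-≤ (v-bounded (≤-trans k≤j (<⇒≤ j<m)))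
      (pigeonhole (m ∸ j) (λ t → v (suc j + t))
        (λ t t<m∸j → ascent-separates ascent k≤j (s≤s (m≤m+n j t)) (after t<m∸j) ,
                     s≤s (v-bounded (after t<m∸j)))
        (λ s t s< t< vs≡vt → +-cancelˡ-≡ (suc j) s t (v-injective (after s<) (after t<) vs≡vt)))
      where
      after : ∀ {t} → t < m ∸ j → suc j + t ≤ m
      after = m<n∸o⇒o+m<n (<⇒≤ j<m)

    run-decreasing : ∀ {a b} → a ≤ b → Run a b → b ≤ m → v b + (b ∸ a) ≤ v a
    run-decreasing {a} a≤b run b≤m with m≤n⇒∃[o]m+o≡n a≤b
    ... | t , refl rewrite m+n∸m≡n a t = steps t run b≤m
      where
      steps : ∀ t → Run a (a + t) → a + t ≤ m → v (a + t) + t ≤ v a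
      steps zero    _   _       = ≤-reflexive (trans (+-identityʳ _) (cong v (+-identityʳ a)))
      steps (suc t) run a+1+t≤m = begin
          v (a + suc t) + suc t     ≡⟨ cong (λ i → v i + suc t) (+-suc a t) ⟩
          v (suc (a + t)) + suc t   ≡⟨ +-suc _ t ⟩
          suc (v (suc (a + t)) + t) ≤⟨ +-monoˡ-≤ t (descent-at a+t<m (run (a + t) (m≤m+n a t) a+t<a+1+t)) ⟩
          v (a + t) + t             ≤⟨ steps t (run-mono ≤-refl (<⇒≤ a+t<a+1+t) run) (<⇒≤ a+t<m) ⟩
          v a                       ∎
        where
        open ≤-Reasoning hiding (start)
        a+t<a+1+t : a + t < a + suc t
        a+t<a+1+t = +-monoʳ-< a (n<1+n t)
        a+t<m : a + t < m
        a+t<m = <-≤-trans a+t<a+1+t a+1+t≤m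

    start≤v-end : ∀ {i} → i ≤ m → start i ≤ v (end i)
    start≤v-end {i} i≤m with start i | start-isStart i | start-≤ i
    ... | zero  | _   | _   = z≤n
    ... | suc j | d≡f | j<i =
      ascent-prefix j<m (ascent-at j<m d≡f) (<-≤-trans j<i (≤-end i)) (end-≤ i≤m)
      where j<m = <-≤-trans j<i i≤m

    v-start≤end : ∀ {i} → i ≤ m → v (start i) ≤ end i
    v-start≤end {i} i≤m with m≤n⇒m<n∨m≡n (end-≤ i≤m) | end-isEnd i≤m
    ... | inj₂ e≡m | _        = subst (v (start i) ≤_) (sym e≡m) (v-bounded (≤-trans (start-≤ i) i≤m))
    ... | inj₁ e<m | inj₁ e≡m = ⊥-elim (<-irrefl e≡m e<m)
    ... | inj₁ e<m | inj₂ d≡f = ascent-suffix e<m (ascent-at e<m d≡f) (≤-trans (start-≤ i) (≤-end i))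

  avoider-layered : ∀ {i} → i ≤ m → v i ≡ π i
  avoider-layered {i} i≤m = ≤-antisym v≤π π≤v
    where
    open ≤-Reasoning hiding (start)
    v≤π : v i ≤ π i
    v≤π = +-cancelʳ-≤ (i ∸ start i) (v i) (π i) (begin
        v i + (i ∸ start i)   ≤⟨ run-decreasing (start-≤ i) (start-run i) i≤m ⟩
        v (start i)           ≤⟨ v-start≤end i≤m ⟩
        end i                 ≡⟨ π+shift≡end i ⟨
        π i + (i ∸ start i)   ∎)
    π≤v : π i ≤ v i
    π≤v = begin
        start i + (end i ∸ i)   ≤⟨ +-monoˡ-≤ (end i ∸ i) (start≤v-end i≤m) ⟩
        v (end i) + (end i ∸ i) ≤⟨ run-decreasing (≤-end i) (end-run i) (end-≤ i≤m) ⟩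
        v i                     ∎

T-not⁺ : ∀ {b} → ¬ T b → T (not b)
T-not⁺ {true}  ¬t = ¬t tt
T-not⁺ {false} _  = tt

T-not⁻ : ∀ {b} → T (not b) → ¬ T b
T-not⁻ {true}  () _
T-not⁻ {false} _  ()

T-does⁻ : ∀ {A : Set} (a? : Dec A) → T (does a?) → A
T-does⁻ (yes a) _ = a

T-does⁺ : ∀ {A : Set} (a? : Dec A) → A → T (does a?)
T-does⁺ (yes _)  _ = tt
T-does⁺ (no ¬a) a = ¬a a

T-implication⁻ : ∀ {A B : Set} (a? : Dec A) (b? : Dec B) → T (not (does a?) ∨ does b?) → A → B
T-implication⁻ (yes _)  b? t _ = T-does⁻ b? t
T-implication⁻ (no ¬a) _  _ a = ⊥-elim (¬a a)

T-implication⁺ : ∀ {A B : Set} (a? : Dec A) (b? : Dec B) → (A → B) → T (not (does a?) ∨ does b?)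
T-implication⁺ (yes a)  b? a→b = T-does⁺ b? (a→b a)
T-implication⁺ (no _)   _  _   = tt

∧-absorbs : ∀ {b r} → (T b → T r) → b ∧ r ≡ b
∧-absorbs {true}  {true}  _   = refl
∧-absorbs {true}  {false} b→r = ⊥-elim (b→r tt)
∧-absorbs {false}         _   = refl

module _ {n : ℕ} (p : Fin n → Bool) where

  all-allFin⁻ : T (all p (allFin n)) → ∀ x → T (p x)
  all-allFin⁻ t = All.tabulate⁻ (all⁺ p (allFin n) t)

  all-allFin⁺ : (∀ x → T (p x)) → T (all p (allFin n))
  all-allFin⁺ h = all⁻ p (All.tabulate⁺ h)

  any-allFin⁻ : T (any p (allFin n)) → ∃ λ x → T (p x)
  any-allFin⁻ t = Any.tabulate⁻ (any⁻ p (allFin n) t)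

  any-allFin⁺ : ∀ x → T (p x) → T (any p (allFin n))
  any-allFin⁺ x t = any⁺ p (Any.tabulate⁺ x t)

count≡sumL : ∀ {A : Set} (p : A → Bool) xs → count p xs ≡ sumL (map (λ x → 𝟙 (p x)) xs)
count≡sumL p []       = refl
count≡sumL p (x ∷ xs) with p x
... | true  = cong suc (count≡sumL p xs)
... | false = count≡sumL p xs

sumL-tabulate : ∀ n {h : Fin n → ℕ} {g : ℕ → ℕ} → (∀ x → h x ≡ g (toℕ x)) → sumL (tabulate h) ≡ ∑< n g
sumL-tabulate zero    h≗g = refl
sumL-tabulate (suc n) h≗g = cong₂ _+_ (h≗g F.zero) (sumL-tabulate n (λ x → h≗g (F.suc x)))

sumL-allFin : ∀ n {f : Fin n → ℕ} {g : ℕ → ℕ} → (∀ x → f x ≡ g (toℕ x)) →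
              sumL (map f (allFin n)) ≡ ∑< n g
sumL-allFin n {f} f≗g = trans (cong sumL (map-tabulate id f)) (sumL-tabulate n f≗g)

count-allFin : ∀ n {p : Fin n → Bool} {b : ℕ → Bool} → (∀ x → p x ≡ b (toℕ x)) →
               count p (allFin n) ≡ ∑[ i < n ] 𝟙 (b i)
count-allFin n {p} p≗b = trans (count≡sumL p (allFin n)) (sumL-allFin n (λ x → cong 𝟙 (p≗b x)))

-- The value 0 at arguments i > m is junk and never used.
clamp : ∀ {m} → ℕ → Fin (suc m)
clamp {m} i with i <? suc m
... | yes i<1+m = F.fromℕ< i<1+m
... | no  _     = F.zero

toℕ-clamp : ∀ {m i} → i ≤ m → toℕ (clamp {m} i) ≡ i
toℕ-clamp {m} {i} i≤m with i <? suc m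
... | yes i<1+m = FP.toℕ-fromℕ< i<1+m
... | no  i≮1+m = ⊥-elim (i≮1+m (s≤s i≤m))

clamp-toℕ : ∀ {m} (x : Fin (suc m)) → clamp (toℕ x) ≡ x
clamp-toℕ x = FP.toℕ-injective (toℕ-clamp (FP.toℕ≤pred[n] x))

record Represents {m : ℕ} (w : Word (suc m)) (v : ℕ → ℕ) : Set where
  constructor represents
  field toℕ-lookup : ∀ x → toℕ (lookup w x) ≡ v (toℕ x)

⟦_⟧ : ∀ {m} → Word (suc m) → ℕ → ℕ
⟦ w ⟧ i = toℕ (lookup w (clamp i))

⟦⟧-represents : ∀ {m} (w : Word (suc m)) → Represents w ⟦ w ⟧
⟦⟧-represents w = represents λ x → cong (λ y → toℕ (lookup w y)) (sym (clamp-toℕ x))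

⟦⟧-bounded : ∀ {m} (w : Word (suc m)) → Bounded m ⟦ w ⟧
⟦⟧-bounded w {i} _ = FP.toℕ≤pred[n] (lookup w (clamp i))

⟦⟧-agrees : ∀ {m} {w : Word (suc m)} {v} → Represents w v → ∀ {i} → i ≤ m → ⟦ w ⟧ i ≡ v i
⟦⟧-agrees {v = v} (represents toℕ-lookup) {i} i≤m = trans (toℕ-lookup (clamp i)) (cong v (toℕ-clamp i≤m))

module _ {m : ℕ} {w : Word (suc m)} (involutive : ∀ x → lookup w (lookup w x) ≡ x) where

  iter-involution : ∀ k x → iter w k x ≡ x ⊎ iter w k x ≡ lookup w x
  iter-involution zero    x = inj₁ refl
  iter-involution (suc k) x with iter-involution k x
  ... | inj₁ wᵏx≡x  = inj₂ (cong (lookup w) wᵏx≡x)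
  ... | inj₂ wᵏx≡wx = inj₁ (trans (cong (lookup w) wᵏx≡wx) (involutive x))

  -- The first conjunct of isCycleMin w x is the test against lookup w x itself.
  isCycleMin-involution : ∀ x → isCycleMin w x ≡ (toℕ x ≤ᵇ toℕ (lookup w x))
  isCycleMin-involution x = ∧-absorbs {r = all below-iterate (tabulate F.suc)} λ x≤wx →
    all⁻ below-iterate (All.tabulate⁺ {f = F.suc} (λ k → later x≤wx (toℕ (F.suc k))))
    where
    below-iterate : Fin (suc m) → Bool
    below-iterate k = toℕ x ≤ᵇ toℕ (iter w (suc (toℕ k)) x)
    later : T (toℕ x ≤ᵇ toℕ (lookup w x)) → ∀ k → T (toℕ x ≤ᵇ toℕ (iter w (suc k) x))
    later x≤wx k with iter-involution (suc k) x
    ... | inj₁ wᵏx≡x  rewrite wᵏx≡x  = ≤⇒≤ᵇ (≤-refl {toℕ x})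
    ... | inj₂ wᵏx≡wx rewrite wᵏx≡wx = x≤wx

module _ {m : ℕ} {w : Word (suc m)} {v : ℕ → ℕ} (w≈v : Represents w v) where

  open Represents w≈v

  private
    distinct-or-equal : Fin (suc m) → Fin (suc m) → Bool
    distinct-or-equal x y = not (does (lookup w x F.≟ lookup w y)) ∨ does (x F.≟ y)

    all-distinct-or-equal : Fin (suc m) → Bool
    all-distinct-or-equal x = all (distinct-or-equal x) (allFin (suc m))

    lookup-injective : T (isPerm w) → ∀ x y → lookup w x ≡ lookup w y → x ≡ y
    lookup-injective perm x y = T-implication⁻ (lookup w x F.≟ lookup w y) (x F.≟ y)
      (all-allFin⁻ (distinct-or-equal x) (all-allFin⁻ all-distinct-or-equal perm x) y)

  isPerm⇒InjectiveUpTo : T (isPerm w) → InjectiveUpTo m v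
  isPerm⇒InjectiveUpTo perm {i} {j} i≤m j≤m vi≡vj = begin
      i                  ≡⟨ toℕ-clamp i≤m ⟨
      toℕ (clamp i)      ≡⟨ cong toℕ (lookup-injective perm (clamp i) (clamp j) (FP.toℕ-injective wi≡wj)) ⟩
      toℕ (clamp j)      ≡⟨ toℕ-clamp j≤m ⟩
      j                  ∎
    where
    open ≡-Reasoning
    wi≡wj : ⟦ w ⟧ i ≡ ⟦ w ⟧ j
    wi≡wj = trans (⟦⟧-agrees w≈v i≤m) (trans vi≡vj (sym (⟦⟧-agrees w≈v j≤m)))

  InjectiveUpTo⇒isPerm : InjectiveUpTo m v → T (isPerm w)
  InjectiveUpTo⇒isPerm injective =
    all-allFin⁺ all-distinct-or-equal λ x → all-allFin⁺ (distinct-or-equal x) λ y →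
      T-implication⁺ (lookup w x F.≟ lookup w y) (x F.≟ y) λ wx≡wy →
        FP.toℕ-injective (injective (FP.toℕ≤pred[n] x) (FP.toℕ≤pred[n] y)
          (trans (sym (toℕ-lookup x)) (trans (cong toℕ wx≡wy) (toℕ-lookup y))))

  private
    pattern231 : Fin (suc m) → Fin (suc m) → Fin (suc m) → Bool
    pattern231 x y z = (toℕ x <ᵇ toℕ y) ∧ (toℕ y <ᵇ toℕ z) ∧
                       (toℕ (lookup w z) <ᵇ toℕ (lookup w x)) ∧ (toℕ (lookup w x) <ᵇ toℕ (lookup w y))

    any231-from : Fin (suc m) → Fin (suc m) → Bool
    any231-from x y = any (pattern231 x y) (allFin (suc m))

    any231-from₁ : Fin (suc m) → Bool
    any231-from₁ x = any (any231-from x) (allFin (suc m))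

    any231 : Bool
    any231 = any any231-from₁ (allFin (suc m))

  avoids231⇒Avoids231 : T (avoids231 w) → Avoids231 m v
  avoids231⇒Avoids231 avoids {i} {j} {k} i<j j<k k≤m vk<vi vi<vj =
    T-not⁻ {any231} avoids
      (any-allFin⁺ any231-from₁ (clamp i)
        (any-allFin⁺ (any231-from (clamp i)) (clamp j)
          (any-allFin⁺ (pattern231 (clamp i) (clamp j)) (clamp k) found)))
    where
    j≤m = ≤-trans (<⇒≤ j<k) k≤m
    i≤m = ≤-trans (<⇒≤ i<j) j≤m
    found : T (pattern231 (clamp i) (clamp j) (clamp k))
    found rewrite toℕ-clamp {m} i≤m | toℕ-clamp {m} j≤m | toℕ-clamp {m} k≤m
                | ⟦⟧-agrees w≈v i≤m | ⟦⟧-agrees w≈v j≤m | ⟦⟧-agrees w≈v k≤m =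
      from T-∧ (<⇒<ᵇ i<j , from T-∧ (<⇒<ᵇ j<k , from T-∧ (<⇒<ᵇ vk<vi , <⇒<ᵇ vi<vj)))

  Avoids231⇒avoids231 : Avoids231 m v → T (avoids231 w)
  Avoids231⇒avoids231 avoids = T-not⁺ {any231} λ t →
    let x , t₁ = any-allFin⁻ any231-from₁ t
        y , t₂ = any-allFin⁻ (any231-from x) t₁
        z , t₃ = any-allFin⁻ (pattern231 x y) t₂
        x<y , rest₁ = to T-∧ t₃
        y<z , rest₂ = to T-∧ rest₁
        wz<wx , wx<wy = to T-∧ rest₂
    in avoids (<ᵇ⇒< _ _ x<y) (<ᵇ⇒< _ _ y<z) (FP.toℕ≤pred[n] z)
         (subst₂ _<_ (toℕ-lookup z) (toℕ-lookup x) (<ᵇ⇒< _ _ wz<wx))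
         (subst₂ _<_ (toℕ-lookup x) (toℕ-lookup y) (<ᵇ⇒< _ _ wx<wy))

  private
    opposite-commutes : Fin (suc m) → Bool
    opposite-commutes x = does (lookup w (F.opposite x) F.≟ F.opposite (lookup w x))

  isCentrosymmetric⇒Centrosymmetric : T (isCentrosymmetric w) → Centrosymmetric m v
  isCentrosymmetric⇒Centrosymmetric centro {i} i≤m = begin
      v (m ∸ i)                      ≡⟨ cong (λ j → v (m ∸ j)) (toℕ-clamp i≤m) ⟨
      v (m ∸ toℕ x)                  ≡⟨ trans (toℕ-lookup (F.opposite x)) (cong v (FP.opposite-prop x)) ⟨
      toℕ (lookup w (F.opposite x))  ≡⟨ cong toℕ (T-does⁻ (_ F.≟ _) (all-allFin⁻ opposite-commutes centro x)) ⟩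
      toℕ (F.opposite (lookup w x))  ≡⟨ FP.opposite-prop (lookup w x) ⟩
      m ∸ ⟦ w ⟧ i                    ≡⟨ cong (m ∸_) (⟦⟧-agrees w≈v i≤m) ⟩
      m ∸ v i                        ∎
    where
    open ≡-Reasoning
    x = clamp i

  Centrosymmetric⇒isCentrosymmetric : Centrosymmetric m v → T (isCentrosymmetric w)
  Centrosymmetric⇒isCentrosymmetric centro =
    all-allFin⁺ opposite-commutes λ x → T-does⁺ (_ F.≟ _) (FP.toℕ-injective (begin
      toℕ (lookup w (F.opposite x))  ≡⟨ toℕ-lookup (F.opposite x) ⟩
      v (toℕ (F.opposite x))         ≡⟨ cong v (FP.opposite-prop x) ⟩
      v (m ∸ toℕ x)                  ≡⟨ centro (FP.toℕ≤pred[n] x) ⟩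
      m ∸ v (toℕ x)                  ≡⟨ cong (m ∸_) (toℕ-lookup x) ⟨
      m ∸ toℕ (lookup w x)           ≡⟨ FP.opposite-prop (lookup w x) ⟨
      toℕ (F.opposite (lookup w x))  ∎))
    where open ≡-Reasoning

  Istat≡∑ : Istat w ≡ ∑[ i < suc m ] ∑[ j < suc m ] 𝟙 ((i <ᵇ j) ∧ (v j <ᵇ v i))
  Istat≡∑ = sumL-allFin (suc m) {g = λ i → ∑[ j < suc m ] 𝟙 ((i <ᵇ j) ∧ (v j <ᵇ v i))} λ x →
    count-allFin (suc m) {b = λ j → (toℕ x <ᵇ j) ∧ (v j <ᵇ v (toℕ x))} λ y →
      cong₂ (λ a b → (toℕ x <ᵇ toℕ y) ∧ (a <ᵇ b)) (toℕ-lookup y) (toℕ-lookup x)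

  Dstat≡∑ : Dstat w ≡ ∑[ i < suc m ] absDiff (v i) i
  Dstat≡∑ = sumL-allFin (suc m) {g = λ i → absDiff (v i) i} λ x →
    cong (λ a → absDiff a (toℕ x)) (toℕ-lookup x)

  cyc≡∑ : (∀ {i} → i ≤ m → v (v i) ≡ i) → cyc w ≡ ∑[ i < suc m ] 𝟙 (i ≤ᵇ v i)
  cyc≡∑ v-involutive = count-allFin (suc m) {b = λ i → i ≤ᵇ v i} λ x →
    trans (isCycleMin-involution {w = w} involutive x) (cong (toℕ x ≤ᵇ_) (toℕ-lookup x))
    where
    involutive : ∀ x → lookup w (lookup w x) ≡ x
    involutive x = FP.toℕ-injective (begin
      toℕ (lookup w (lookup w x))  ≡⟨ toℕ-lookup (lookup w x) ⟩
      v (toℕ (lookup w x))         ≡⟨ cong v (toℕ-lookup x) ⟩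
      v (v (toℕ x))                ≡⟨ v-involutive (FP.toℕ≤pred[n] x) ⟩
      toℕ x                        ∎)
      where open ≡-Reasoning

module _ (m : ℕ) (d : ℕ → Bool) where

  open Layered m d

  layeredWord : Word (suc m)
  layeredWord = V.tabulate (λ x → clamp (π (toℕ x)))

  layeredWord-represents : Represents layeredWord π
  layeredWord-represents = represents λ x →
    trans (cong toℕ (lookup∘tabulate (λ y → clamp (π (toℕ y))) x)) (toℕ-clamp (π-bounded (FP.toℕ≤pred[n] x)))

  private
    w≈π : Represents layeredWord π
    w≈π = layeredWord-represents

  layeredWord-shallow : T (isShallow layeredWord)
  layeredWord-shallow = ≡⇒≡ᵇ _ _ (begin
      Istat layeredWord + Tstat layeredWord
    ≡⟨ cong₂ _+_ (trans (Istat≡∑ w≈π) (∑-cong (suc m) (λ i i≤m → inversions-from (s≤s⁻¹ i≤m))))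
                 (trans (cong (suc m ∸_) (cyc≡∑ w≈π π-involutive)) (∑-𝟙-complement (suc m) id π)) ⟩
      ∑[ i < suc m ] (end i ∸ i) + ∑[ i < suc m ] 𝟙 (π i <ᵇ i)
    ≡⟨ layered-shallow ⟩
      ∑[ i < suc m ] absDiff (π i) i
    ≡⟨ Dstat≡∑ w≈π ⟨
      Dstat layeredWord ∎)
    where open ≡-Reasoning

  layeredWord-ok : Palindromic m d → T (isShallow231Centro layeredWord)
  layeredWord-ok palindromic =
    from (T-∧ {isPerm layeredWord}) (InjectiveUpTo⇒isPerm w≈π π-injective ,
    from (T-∧ {isShallow layeredWord}) (layeredWord-shallow ,
    from (T-∧ {avoids231 layeredWord}) (Avoids231⇒avoids231 w≈π π-avoids-231 ,
                                         Centrosymmetric⇒isCentrosymmetric w≈π (π-reflect palindromic))))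

module _ {m : ℕ} {w : Word (suc m)} (ok : T (isShallow231Centro w)) where

  private
    perm : T (isPerm w)
    perm = proj₁ (to (T-∧ {isPerm w}) ok)
    avoids∧centro : T (avoids231 w ∧ isCentrosymmetric w)
    avoids∧centro = proj₂ (to (T-∧ {isShallow w}) (proj₂ (to (T-∧ {isPerm w}) ok)))
    avoids-231 : Avoids231 m ⟦ w ⟧
    avoids-231 = avoids231⇒Avoids231 (⟦⟧-represents w) (proj₁ (to (T-∧ {avoids231 w}) avoids∧centro))

  ⟦⟧-centrosymmetric : Centrosymmetric m ⟦ w ⟧
  ⟦⟧-centrosymmetric =
    isCentrosymmetric⇒Centrosymmetric (⟦⟧-represents w) (proj₂ (to (T-∧ {avoids231 w}) avoids∧centro))

  ⟦⟧-layered : ∀ d → (∀ {j} → j < m → d j ≡ descents ⟦ w ⟧ j) → ∀ {i} → i ≤ m → ⟦ w ⟧ i ≡ Layered.π m d i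
  ⟦⟧-layered = avoider-layered (⟦⟧-bounded w) (isPerm⇒InjectiveUpTo (⟦⟧-represents w) perm) avoids-231
                 (reverse-complement-231⇒312 (⟦⟧-bounded w) ⟦⟧-centrosymmetric avoids-231)

ShallowCentro231-≡ : ∀ {n} {w w′ : Word n} {p : T (isShallow231Centro w)} {q : T (isShallow231Centro w′)} →
                     w ≡ w′ → _≡_ {A = ShallowCentro231 n} (w , p) (w′ , q)
ShallowCentro231-≡ {p = p} {q} refl = cong (_ ,_) (T-irrelevant p q)

-- Counting

_‼_ : ∀ {k} → Vec Bool k → ℕ → Bool
V.[]       ‼ _     = false
(b V.∷ _)  ‼ zero  = b
(_ V.∷ bs) ‼ suc i = bs ‼ i

‼-toℕ : ∀ {k} (bs : Vec Bool k) x → bs ‼ toℕ x ≡ lookup bs x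
‼-toℕ (_ V.∷ _)  F.zero    = refl
‼-toℕ (_ V.∷ bs) (F.suc x) = ‼-toℕ bs x

tabulate-‼ : ∀ {k} (f : ℕ → Bool) {i} → i < k → V.tabulate {n = k} (λ x → f (toℕ x)) ‼ i ≡ f i
tabulate-‼ {suc k} f {zero}  _   = refl
tabulate-‼ {suc k} f {suc i} i<k = tabulate-‼ (λ j → f (suc j)) (s≤s⁻¹ i<k)

Vec-Bool↔Fin-2^ : ∀ k → Vec Bool k ↔ Fin (2 ^ k)
Vec-Bool↔Fin-2^ zero    =
  mk↔ₛ′ (λ _ → F.zero) (λ _ → V.[]) (λ { F.zero → refl ; (F.suc ()) }) (λ { V.[] → refl })
Vec-Bool↔Fin-2^ (suc k) =
  ↔-trans uncons (↔-trans (↔-sym FP.2↔Bool ×-↔ Vec-Bool↔Fin-2^ k) (↔-sym FP.*↔×))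
  where
  uncons : Vec Bool (suc k) ↔ (Bool × Vec Bool k)
  uncons = mk↔ₛ′ (λ { (b V.∷ bs) → b , bs }) (λ { (b , bs) → b V.∷ bs }) (λ _ → refl) (λ { (_ V.∷ _) → refl })

module Counting (m : ℕ) where

  H : ℕ
  H = suc m / 2

  private
    double : ∀ k → suc k * 2 ≡ suc (k + suc k)
    double = solve-∀

  k<H⇒k+1+k≤m : ∀ {k} → k < H → k + suc k ≤ m
  k<H⇒k+1+k≤m {k} k<H = s≤s⁻¹ (begin
      suc (k + suc k)  ≡⟨ double k ⟨
      suc k * 2        ≤⟨ *-monoˡ-≤ 2 k<H ⟩
      H * 2            ≤⟨ m/n*n≤m (suc m) 2 ⟩
      suc m            ∎)
    where open ≤-Reasoning

  k+1+k≤m⇒k<H : ∀ {k} → k + suc k ≤ m → k < H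
  k+1+k≤m⇒k<H {k} k+1+k≤m = begin
      suc k            ≡⟨ m*n/n≡m (suc k) 2 ⟨
      suc k * 2 / 2    ≤⟨ /-monoˡ-≤ 2 (≤-trans (≤-reflexive (double k)) (s≤s k+1+k≤m)) ⟩
      H                ∎
    where open ≤-Reasoning

  <H⇒<m : ∀ {k} → k < H → k < m
  <H⇒<m {k} k<H = ≤-trans (m≤n+m (suc k) k) (k<H⇒k+1+k≤m k<H)

  -- Gaps j and m ∸ suc j are governed by the same bit, number fold j.
  fold : ℕ → ℕ
  fold j = j ⊓ (m ∸ suc j)

  fold-<H : ∀ {j} → j < m → fold j < H
  fold-<H {j} j<m = k+1+k≤m⇒k<H (≤-trans
    (+-mono-≤ (m⊓n≤n j (m ∸ suc j)) (s≤s (m⊓n≤m j (m ∸ suc j)))) (≤-reflexive (m∸n+n≡m j<m)))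

  fold-<H-id : ∀ {k} → k < H → fold k ≡ k
  fold-<H-id {k} k<H = m≤n⇒m⊓n≡m (m+n≤o⇒m≤o∸n k (k<H⇒k+1+k≤m k<H))

  fold-reflect : ∀ {j} → j < m → fold (m ∸ suc j) ≡ fold j
  fold-reflect {j} j<m = trans (cong ((m ∸ suc j) ⊓_) (∸-suc-involutive j<m)) (⊓-comm (m ∸ suc j) j)

  fold-palindromic : ∀ {e : ℕ → Bool} → Palindromic m e → ∀ {j} → j < m → e (fold j) ≡ e j
  fold-palindromic {e} palindromic {j} j<m with j ≤? m ∸ suc j
  ... | yes j≤j′ = cong e (m≤n⇒m⊓n≡m j≤j′)
  ... | no  j≰j′ = trans (cong e (m≥n⇒m⊓n≡n (<⇒≤ (≰⇒> j≰j′)))) (palindromic j<m)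

  mirror : Vec Bool H → ℕ → Bool
  mirror bs j = bs ‼ fold j

  mirror-palindromic : ∀ bs → Palindromic m (mirror bs)
  mirror-palindromic bs j<m = cong (bs ‼_) (fold-reflect j<m)

  encode : Vec Bool H → ShallowCentro231 (suc m)
  encode bs = layeredWord m (mirror bs) , layeredWord-ok m (mirror bs) (mirror-palindromic bs)

  decode : ShallowCentro231 (suc m) → Vec Bool H
  decode (w , _) = V.tabulate (λ x → descents ⟦ w ⟧ (toℕ x))

  decode∘encode : ∀ bs → decode (encode bs) ≡ bs
  decode∘encode bs = trans (tabulate-cong descent-x) (tabulate∘lookup bs)
    where
    open Layered m (mirror bs)
    descent-x : ∀ x → descents ⟦ layeredWord m (mirror bs) ⟧ (toℕ x) ≡ lookup bs x
    descent-x x = begin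
        descents ⟦ layeredWord m (mirror bs) ⟧ k
      ≡⟨ cong₂ _<ᵇ_ (⟦⟧-agrees w≈π k<m) (⟦⟧-agrees w≈π (<⇒≤ k<m)) ⟩
        descents π k
      ≡⟨ π-descents k<m ⟩
        bs ‼ fold k
      ≡⟨ cong (bs ‼_) (fold-<H-id (FP.toℕ<n x)) ⟩
        bs ‼ k
      ≡⟨ ‼-toℕ bs x ⟩
        lookup bs x ∎
      where
      open ≡-Reasoning
      w≈π = layeredWord-represents m (mirror bs)
      k = toℕ x
      k<m = <H⇒<m (FP.toℕ<n x)

  encode∘decode : ∀ σ → encode (decode σ) ≡ σ
  encode∘decode (w , ok) = ShallowCentro231-≡ (trans (tabulate-cong entry) (tabulate∘lookup w))
    where
    d = mirror (decode (w , ok))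
    d-descents : ∀ {j} → j < m → d j ≡ descents ⟦ w ⟧ j
    d-descents j<m = trans (tabulate-‼ (descents ⟦ w ⟧) (fold-<H j<m))
      (fold-palindromic (descents-palindromic (⟦⟧-bounded w) (⟦⟧-centrosymmetric {w = w} ok)) j<m)
    entry : ∀ x → clamp (Layered.π m d (toℕ x)) ≡ lookup w x
    entry x = trans (cong clamp (sym (trans (Represents.toℕ-lookup (⟦⟧-represents w) x)
                                            (⟦⟧-layered {w = w} ok d d-descents (FP.toℕ≤pred[n] x)))))
                    (clamp-toℕ (lookup w x))

  ShallowCentro231↔Vec : ShallowCentro231 (suc m) ↔ Vec Bool H
  ShallowCentro231↔Vec = mk↔ₛ′ decode encode decode∘encode encode∘decode

theorem4p8 : (n : ℕ) → n ≥ 1 → ShallowCentro231 n ↔ Fin (2 ^ (n / 2))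
theorem4p8 (suc m) _ = ↔-trans (Counting.ShallowCentro231↔Vec m) (Vec-Bool↔Fin-2^ (suc m / 2))
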